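{- Let $f:\mathbb{Z}_{>0}\to\mathbb{C}$ be any function. Then, as formal power series in $q$, \[ \Big\langle \sum_{\substack{\lambda_i \in \lambda \\ \lambda_i \text{ distinct}}}f(\lambda_i)\Big\rangle_q = \sum_{n=1}^{\infty} f(n)\, q^n. \]
   Context: For a function $g$ from the set $\mathcal{P}$ of integer partitions to $\mathbb{C}$, the $q$-bracket is $\langle g\rangle_q := (q;q)_\infty \sum_{n=0}^{\infty} q^n \sum_{\lambda\vdash n} g(\lambda)\in\mathbb{C}[[q]]$, where $(q;q)_\infty=\prod_{k\ge1}(1-q^k)$ and $\lambda\vdash n$ means $\lambda$ is a partition of $n$. The function being bracketed is $\lambda\mapsto\sum_{\lambda_i\in\lambda,\ \lambda_i\text{ distinct}} f(\lambda_i)$, the sum of $f$ over the distinct part sizes of $\lambda$, each counted once regardless of multiplicity (e.g. for $\lambda=(1,1,2,4,4,5)$ it is $f(1)+f(2)+f(4)+f(5)$); it equals $0$ for the empty partition. -}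

module Defs where

open import Level using (Level)
open import Algebra.Bundles using (CommutativeRing)
open import Data.Nat using (ℕ; zero; suc; _∸_; _≤?_; _≟_) renaming (_*_ to _*ℕ_)
open import Data.Bool using (if_then_else_)
open import Data.List using (List; []; _∷_; _++_; map; concatMap; filter; upTo; replicate; foldr; deduplicate)
open import Relation.Nullary.Decidable using (⌊_⌋)

-- Integer partitions of n, as lists of positive parts in non-increasing order.
-- partsLe n m : all partitions of n whose parts are all ≤ m
-- (choose the multiplicity k of the part m, then recurse on smaller parts).
partsLe : ℕ → ℕ → List (List ℕ)
partsLe zero    zero    = [] ∷ []
partsLe (suc _) zero    = []
partsLe n       (suc m) =
  concatMap (λ k → map (replicate k (suc m) ++_) (partsLe (n ∸ k *ℕ suc m) m))
            (filter (λ k → k *ℕ suc m ≤? n) (upTo (suc n)))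

partitions : ℕ → List (List ℕ)
partitions n = partsLe n n

distinctParts : List ℕ → List ℕ
distinctParts = deduplicate _≟_

module _ {c ℓ : Level} (R : CommutativeRing c ℓ) where
  open CommutativeRing R

  Series : Set c
  Series = ℕ → Carrier

  sumList : List Carrier → Carrier
  sumList = foldr _+_ 0#

  sumTo : ℕ → (ℕ → Carrier) → Carrier
  sumTo zero    a = a 0
  sumTo (suc n) a = sumTo n a + a (suc n)

  _⊛_ : Series → Series → Series
  (a ⊛ b) n = sumTo n (λ k → a k * b (n ∸ k))

  oneS : Series
  oneS n = if ⌊ n ≟ 0 ⌋ then 1# else 0#

  oneMinusQ^ : ℕ → Series
  oneMinusQ^ j n = oneS n + (if ⌊ n ≟ j ⌋ then - 1# else 0#)

  qPochTo : ℕ → Series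
  qPochTo zero    = oneS
  qPochTo (suc m) = qPochTo m ⊛ oneMinusQ^ (suc m)

  -- (q;q)_∞ : its q^n coefficient equals that of ∏_{j=1}^{n} (1 - q^j)
  qqInf : Series
  qqInf n = qPochTo n n

  -- the q-bracket  <g>_q = (q;q)_∞ Σ_n q^n Σ_{λ ⊢ n} g(λ)
  qBracket : (List ℕ → Carrier) → Series
  qBracket g = qqInf ⊛ (λ n → sumList (map g (partitions n)))

  distinctPartSum : (ℕ → Carrier) → List ℕ → Carrier
  distinctPartSum f λ' = sumList (map f (distinctParts λ'))

  posSeries : (ℕ → Carrier) → Series
  posSeries f zero    = 0#
  posSeries f (suc n) = f (suc n)

module Submission where

-- Notation: J = m + 1, g(λ) = Σ of f over the distinct parts of λ, and for a
-- weight φ on partitions, partSum φ m = Σ_n q^n Σ_{λ ⊢ n, parts ≤ m} φ(λ).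
-- Let C_m = partSum 1 m and S_m = partSum g m.  Sorting the partitions with
-- parts ≤ J by whether they contain J, and writing T_J = partSum (g ∘ (J ∷_)) J,
--   C_J = C_m + q^J C_J,   S_J = S_m + q^J T_J,   T_J = f(J) C_m + S_m + q^J T_J,
-- because g(J ∷ μ) = f(J) + g(μ) when all parts of μ are < J, and a repeated J
-- does not change g.  Hence T_J = S_J + f(J) C_m, and
--   (1 - q^J) C_J = C_m,   (1 - q^J) S_J = S_m + f(J) q^J C_m.
-- By induction on m this gives (q;q)_m C_m = 1 and (q;q)_m S_m = Σ_{1 ≤ j ≤ m} f(j) q^j.
-- Finally (q;q)_m and S_m agree with (q;q)_∞ and S_∞ in degrees ≤ m, so taking
-- m = n yields the coefficient of q^n in the theorem.

open import Defs hiding (_⊛_)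
import Defs
open import Level using (Level)
open import Algebra.Bundles using (CommutativeRing)
open import Data.Nat using (ℕ; zero; suc; _∸_; _≤_; _<_; z≤n; s≤s)
  renaming (_+_ to _+ℕ_; _*_ to _*ℕ_)
open import Data.Nat.Properties
  using (_≟_; _≤?_; ≤-refl; ≤-trans; ≤-<-connex; m≤n⇒m≤1+n; m≤n⇒m<n∨m≡n; ≤∧≢⇒<; <⇒≤; <⇒≢; <⇒≱
        ; +-suc; +-cancelˡ-≤; +-monoʳ-≤; m≤m+n; m≤n+m; m≤m*n; m∸n≤m; m+[n∸m]≡n; m∸n+n≡m
        ; m∸[m∸n]≡n; [m+n]∸[m+o]≡n∸o; n∸n≡0; m>n⇒m∸n≢0; m+n∸n≡m)
import Data.Nat.Properties as ℕ
open import Data.List using (List; []; _∷_; _++_; [_]; map; concatMap; filter; upTo; applyUpTo; replicate; deduplicate)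
open import Data.List.Properties
  using (map-id; map-∘; map-upTo; ++-identityʳ; upTo-∷ʳ; concatMap-map; concatMap-cong; map-concatMap
        ; filter-++; filter-accept; filter-reject; filter-none; filter-all; filter-idem; filter-≐)
open import Data.List.Relation.Unary.All as All using (All; []; _∷_)
open import Data.List.Relation.Unary.All.Properties
  using (map⁺; ++⁺; concat⁺; replicate⁺; deduplicate⁺; applyUpTo⁺₂)
open import Data.Bool using (true; false; if_then_else_)
open import Data.Sum using (inj₁; inj₂)
open import Data.Product using (_,_)
open import Function using (_∘_)
open import Relation.Nullary using (¬_; does; yes; no; contradiction)
open import Relation.Nullary.Decidable using (⌊_⌋; ¬?)
open import Relation.Unary using (Pred; Decidable)
import Relation.Binary.PropositionalEquality as ≡
open ≡ using (_≡_; _≢_)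

-- Combinatorics of the enumeration partsLe n m of the partitions of n with parts ≤ m.
module PartitionLists where
  open ≡ using (refl; cong; cong₂; sym; trans; subst)
  open ≡.≡-Reasoning

  filter-map : ∀ {A B : Set} {p} {P : Pred B p} (P? : Decidable P) (h : A → B) xs →
               filter P? (map h xs) ≡ map h (filter (P? ∘ h) xs)
  filter-map P? h []       = refl
  filter-map P? h (x ∷ xs) with does (P? (h x))
  ... | true  = cong (h x ∷_) (filter-map P? h xs)
  ... | false = filter-map P? h xs

  filter-upTo-beyond : ∀ {p} {P : Pred ℕ p} (P? : Decidable P) M d → (∀ k → M ≤ k → ¬ P k) →
                       filter P? (upTo (d +ℕ M)) ≡ filter P? (upTo M)
  filter-upTo-beyond P? M zero    _  = refl
  filter-upTo-beyond P? M (suc d) ¬P = begin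
    filter P? (upTo (suc (d +ℕ M)))                  ≡⟨ cong (filter P?) (sym (upTo-∷ʳ (d +ℕ M))) ⟩
    filter P? (upTo (d +ℕ M) ++ [ d +ℕ M ])          ≡⟨ filter-++ P? (upTo (d +ℕ M)) [ d +ℕ M ] ⟩
    filter P? (upTo (d +ℕ M)) ++ filter P? [ d +ℕ M ] ≡⟨ cong (filter P? (upTo (d +ℕ M)) ++_)
                                                           (filter-reject P? (¬P (d +ℕ M) (m≤n+m M d))) ⟩
    filter P? (upTo (d +ℕ M)) ++ []                   ≡⟨ ++-identityʳ _ ⟩
    filter P? (upTo (d +ℕ M))                         ≡⟨ filter-upTo-beyond P? M d ¬P ⟩
    filter P? (upTo M)                                ∎

  multiplicities : ℕ → ℕ → List ℕ
  multiplicities m n = filter (λ k → k *ℕ suc m ≤? n) (upTo (suc n))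

  withCopies : ℕ → ℕ → ℕ → List (List ℕ)
  withCopies m n k = map (replicate k (suc m) ++_) (partsLe (n ∸ k *ℕ suc m) m)

  partsLe-byMultiplicity : ∀ m n → partsLe n (suc m) ≡ concatMap (withCopies m n) (multiplicities m n)
  partsLe-byMultiplicity m zero    = refl
  partsLe-byMultiplicity m (suc n) = refl

  multiplicities-head : ∀ m n →
    multiplicities m n ≡ 0 ∷ map suc (filter (λ k → suc k *ℕ suc m ≤? n) (upTo n))
  multiplicities-head m n = begin
    filter Q? (upTo (suc n))                  ≡⟨ filter-accept Q? {xs = applyUpTo suc n} z≤n ⟩
    0 ∷ filter Q? (applyUpTo suc n)           ≡⟨ cong (λ ks → 0 ∷ filter Q? ks) (sym (map-upTo suc n)) ⟩
    0 ∷ filter Q? (map suc (upTo n))          ≡⟨ cong (0 ∷_) (filter-map Q? suc (upTo n)) ⟩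
    0 ∷ map suc (filter (Q? ∘ suc) (upTo n))  ∎
    where
    Q? : Decidable (λ k → k *ℕ suc m ≤ n)
    Q? k = k *ℕ suc m ≤? n

  multiplicities-large : ∀ m r → multiplicities m (suc m +ℕ r) ≡ 0 ∷ map suc (multiplicities m r)
  multiplicities-large m r = trans (multiplicities-head m (J +ℕ r)) (cong (λ ks → 0 ∷ map suc ks) (begin
    filter (λ k → suc k *ℕ J ≤? J +ℕ r) (upTo (J +ℕ r))
      ≡⟨ filter-≐ (λ k → suc k *ℕ J ≤? J +ℕ r) Q? (+-cancelˡ-≤ J _ _ , +-monoʳ-≤ J) _ ⟩
    filter Q? (upTo (suc (m +ℕ r)))  ≡⟨ cong (filter Q? ∘ upTo) (sym (+-suc m r)) ⟩
    filter Q? (upTo (m +ℕ suc r))    ≡⟨ filter-upTo-beyond Q? (suc r) m tooLarge ⟩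
    filter Q? (upTo (suc r))         ∎))
    where
    J : ℕ
    J = suc m
    Q? : Decidable (λ k → k *ℕ J ≤ r)
    Q? k = k *ℕ J ≤? r
    tooLarge : ∀ k → suc r ≤ k → ¬ (k *ℕ J ≤ r)
    tooLarge k r<k kJ≤r = <⇒≱ r<k (≤-trans (m≤m*n k J) kJ≤r)

  multiplicities-small : ∀ m n → n < suc m → multiplicities m n ≡ 0 ∷ []
  multiplicities-small m n n<J = trans (multiplicities-head m n)
    (cong (λ ks → 0 ∷ map suc ks) (filter-none (λ k → suc k *ℕ suc m ≤? n)
      (applyUpTo⁺₂ (λ k → k) n (λ k J≤n → <⇒≱ n<J (≤-trans (m≤m+n (suc m) _) J≤n)))))

  withCopies-suc : ∀ m r k → withCopies m (suc m +ℕ r) (suc k) ≡ map (suc m ∷_) (withCopies m r k)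
  withCopies-suc m r k = trans
    (cong (map (replicate (suc k) (suc m) ++_) ∘ (λ j → partsLe j m)) ([m+n]∸[m+o]≡n∸o (suc m) r (k *ℕ suc m)))
    (map-∘ (partsLe (r ∸ k *ℕ suc m) m))

  partsLe-split+ : ∀ m r → partsLe (suc m +ℕ r) (suc m) ≡
                   partsLe (suc m +ℕ r) m ++ map (suc m ∷_) (partsLe r (suc m))
  partsLe-split+ m r = begin
    concatMap (copies n) (multiplicities m n)
      ≡⟨ cong (concatMap (copies n)) (multiplicities-large m r) ⟩
    copies n 0 ++ concatMap (copies n) (map suc (multiplicities m r))
      ≡⟨ cong₂ _++_ (map-id (partsLe n m)) (concatMap-map (copies n) suc (multiplicities m r)) ⟩
    partsLe n m ++ concatMap (copies n ∘ suc) (multiplicities m r)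
      ≡⟨ cong (partsLe n m ++_) (concatMap-cong (withCopies-suc m r) (multiplicities m r)) ⟩
    partsLe n m ++ concatMap (map (suc m ∷_) ∘ copies r) (multiplicities m r)
      ≡⟨ cong (partsLe n m ++_) (sym (map-concatMap (suc m ∷_) (copies r) (multiplicities m r))) ⟩
    partsLe n m ++ map (suc m ∷_) (concatMap (copies r) (multiplicities m r))
      ≡⟨ cong (λ ps → partsLe n m ++ map (suc m ∷_) ps) (sym (partsLe-byMultiplicity m r)) ⟩
    partsLe n m ++ map (suc m ∷_) (partsLe r (suc m))
      ∎
    where
    n : ℕ
    n = suc m +ℕ r
    copies : ℕ → ℕ → List (List ℕ)
    copies = withCopies m

  partsLe-split : ∀ m n → suc m ≤ n →
                  partsLe n (suc m) ≡ partsLe n m ++ map (suc m ∷_) (partsLe (n ∸ suc m) (suc m))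
  partsLe-split m n J≤n =
    subst (λ n′ → partsLe n′ (suc m) ≡ partsLe n′ m ++ map (suc m ∷_) (partsLe (n ∸ suc m) (suc m)))
          (m+[n∸m]≡n J≤n) (partsLe-split+ m (n ∸ suc m))

  partsLe-small : ∀ m n → n < suc m → partsLe n (suc m) ≡ partsLe n m
  partsLe-small m n n<J = begin
    partsLe n (suc m)                                ≡⟨ partsLe-byMultiplicity m n ⟩
    concatMap (withCopies m n) (multiplicities m n)  ≡⟨ cong (concatMap (withCopies m n)) (multiplicities-small m n n<J) ⟩
    withCopies m n 0 ++ []                           ≡⟨ ++-identityʳ _ ⟩
    withCopies m n 0                                 ≡⟨ map-id (partsLe n m) ⟩
    partsLe n m                                      ∎

  partsLe-bounded : ∀ n m → All (All (_≤ m)) (partsLe n m)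
  partsLe-bounded zero    zero    = [] ∷ []
  partsLe-bounded (suc n) zero    = []
  partsLe-bounded n       (suc m) = subst (All (All (_≤ suc m))) (sym (partsLe-byMultiplicity m n))
    (concat⁺ (map⁺ (All.universal copiesBounded (multiplicities m n))))
    where
    copiesBounded : ∀ k → All (All (_≤ suc m)) (withCopies m n k)
    copiesBounded k = map⁺ (All.map (λ μ≤m → ++⁺ (replicate⁺ k ≤-refl) (All.map m≤n⇒m≤1+n μ≤m))
                                    (partsLe-bounded (n ∸ k *ℕ suc m) m))

  distinctParts-fresh : ∀ x xs → All (x ≢_) xs → distinctParts (x ∷ xs) ≡ x ∷ distinctParts xs
  distinctParts-fresh x xs fresh = cong (x ∷_) (filter-all (¬? ∘ (x ≟_)) (deduplicate⁺ _≟_ fresh))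

  distinctParts-repeat : ∀ x xs → distinctParts (x ∷ x ∷ xs) ≡ distinctParts (x ∷ xs)
  distinctParts-repeat x xs = cong (x ∷_)
    (trans (filter-reject (¬? ∘ (x ≟_)) (λ x≢x → x≢x refl)) (filter-idem (¬? ∘ (x ≟_)) (deduplicate _≟_ xs)))

-- Formal power series over a commutative ring R, as coefficient sequences.
module PowerSeries {c ℓ : Level} (R : CommutativeRing c ℓ) where
  open CommutativeRing R hiding (zero)
  open import Algebra.Properties.Ring ring using (-0#≈0#; -‿+-comm; -1*x≈-x; [y-z]x≈yx-zx; //-rightDividesʳ)
  open import Algebra.Properties.CommutativeSemigroup +-commutativeSemigroup using (interchange)
  open import Relation.Binary.Reasoning.Setoid setoid

  ∑ : ℕ → (ℕ → Carrier) → Carrier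
  ∑ = sumTo R

  ∑-cong : ∀ n {a b : ℕ → Carrier} → (∀ k → k ≤ n → a k ≈ b k) → ∑ n a ≈ ∑ n b
  ∑-cong zero    a≈b = a≈b 0 z≤n
  ∑-cong (suc n) a≈b = +-cong (∑-cong n (λ k k≤n → a≈b k (m≤n⇒m≤1+n k≤n))) (a≈b (suc n) ≤-refl)

  ∑-+ : ∀ n a b → ∑ n (λ k → a k + b k) ≈ ∑ n a + ∑ n b
  ∑-+ zero    a b = refl
  ∑-+ (suc n) a b = trans (+-congʳ (∑-+ n a b)) (interchange _ _ _ _)

  ∑-neg : ∀ n a → ∑ n (λ k → - a k) ≈ - ∑ n a
  ∑-neg zero    a = refl
  ∑-neg (suc n) a = trans (+-congʳ (∑-neg n a)) (-‿+-comm _ _)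

  ∑-*ˡ : ∀ n x a → ∑ n (λ k → x * a k) ≈ x * ∑ n a
  ∑-*ˡ zero    x a = refl
  ∑-*ˡ (suc n) x a = trans (+-congʳ (∑-*ˡ n x a)) (sym (distribˡ x _ _))

  ∑-zero : ∀ n a → (∀ k → k ≤ n → a k ≈ 0#) → ∑ n a ≈ 0#
  ∑-zero zero    a a≈0 = a≈0 0 z≤n
  ∑-zero (suc n) a a≈0 =
    trans (+-cong (∑-zero n a (λ k k≤n → a≈0 k (m≤n⇒m≤1+n k≤n))) (a≈0 (suc n) ≤-refl)) (+-identityʳ 0#)

  ∑-single : ∀ n p a → p ≤ n → (∀ k → k ≤ n → k ≢ p → a k ≈ 0#) → ∑ n a ≈ a p
  ∑-single zero    .zero a z≤n _   = refl
  ∑-single (suc n) p     a p≤1+n a≈0 with m≤n⇒m<n∨m≡n p≤1+n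
  ... | inj₁ (s≤s p≤n) = begin
    ∑ n a + a (suc n) ≈⟨ +-cong (∑-single n p a p≤n (λ k k≤n → a≈0 k (m≤n⇒m≤1+n k≤n)))
                                (a≈0 (suc n) ≤-refl (<⇒≢ (s≤s p≤n) ∘ ≡.sym)) ⟩
    a p + 0#          ≈⟨ +-identityʳ _ ⟩
    a p               ∎
  ... | inj₂ ≡.refl = begin
    ∑ n a + a (suc n) ≈⟨ +-congʳ (∑-zero n a (λ k k≤n → a≈0 k (m≤n⇒m≤1+n k≤n) (<⇒≢ (s≤s k≤n)))) ⟩
    0# + a (suc n)    ≈⟨ +-identityˡ _ ⟩
    a (suc n)         ∎

  ∑-peel : ∀ n a → ∑ (suc n) a ≈ a 0 + ∑ n (a ∘ suc)
  ∑-peel zero    a = refl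
  ∑-peel (suc n) a = trans (+-congʳ (∑-peel n a)) (+-assoc _ _ _)

  ∑-reverse : ∀ n a → ∑ n a ≈ ∑ n (λ k → a (n ∸ k))
  ∑-reverse zero    a = refl
  ∑-reverse (suc n) a = begin
    ∑ n a + a (suc n)                  ≈⟨ +-congʳ (∑-reverse n a) ⟩
    ∑ n (λ k → a (n ∸ k)) + a (suc n)  ≈⟨ +-comm _ _ ⟩
    a (suc n) + ∑ n (λ k → a (n ∸ k))  ≈⟨ sym (∑-peel n (λ k → a (suc n ∸ k))) ⟩
    ∑ (suc n) (λ k → a (suc n ∸ k))    ∎

  ∑-dropInitial : ∀ m j a → (∀ k → k < j → a k ≈ 0#) → ∑ (m +ℕ j) a ≈ ∑ m (λ k → a (k +ℕ j))
  ∑-dropInitial zero    j a a≈0 = ∑-single j j a ≤-refl (λ k k≤j k≢j → a≈0 k (≤∧≢⇒< k≤j k≢j))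
  ∑-dropInitial (suc m) j a a≈0 = +-congʳ (∑-dropInitial m j a a≈0)

  infix  4 _≋_
  infixl 6 _⊕_ _⊝_
  infixl 7 _⊛_
  infixr 7 _·_

  _≋_ : Series R → Series R → Set ℓ
  a ≋ b = ∀ n → a n ≈ b n

  _⊕_ : Series R → Series R → Series R
  (a ⊕ b) n = a n + b n

  _⊝_ : Series R → Series R → Series R
  (a ⊝ b) n = a n - b n

  _·_ : Carrier → Series R → Series R
  (x · a) n = x * a n

  _⊛_ : Series R → Series R → Series R
  _⊛_ = Defs._⊛_ R

  shift : ℕ → Series R → Series R
  shift j a n with j ≤? n
  ... | yes _ = a (n ∸ j)
  ... | no  _ = 0#

  -- The monomial x q^j; note oneS R = monomial 1# 0 and oneMinusQ^ R j = monomial 1# 0 ⊕ monomial (- 1#) j.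
  monomial : Carrier → ℕ → Series R
  monomial x j n = if ⌊ n ≟ j ⌋ then x else 0#

  shift-above : ∀ j a {n} → j ≤ n → shift j a n ≈ a (n ∸ j)
  shift-above j a {n} j≤n with j ≤? n
  ... | yes _   = refl
  ... | no  j≰n = contradiction j≤n j≰n

  shift-below : ∀ j a {n} → n < j → shift j a n ≈ 0#
  shift-below j a {n} n<j with j ≤? n
  ... | yes j≤n = contradiction j≤n (<⇒≱ n<j)
  ... | no  _   = refl

  shift-cong : ∀ j {a b} → a ≋ b → shift j a ≋ shift j b
  shift-cong j a≋b n with j ≤? n
  ... | yes _ = a≋b (n ∸ j)
  ... | no  _ = refl

  shift-⊕ : ∀ j a b → shift j (a ⊕ b) ≋ shift j a ⊕ shift j b
  shift-⊕ j a b n with j ≤? n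
  ... | yes _ = refl
  ... | no  _ = sym (+-identityʳ 0#)

  monomial-at : ∀ x j → monomial x j j ≈ x
  monomial-at x j with j ≟ j
  ... | yes _   = refl
  ... | no  j≢j = contradiction ≡.refl j≢j

  monomial-off : ∀ x j {n} → n ≢ j → monomial x j n ≈ 0#
  monomial-off x j {n} n≢j with n ≟ j
  ... | yes n≡j = contradiction n≡j n≢j
  ... | no  _   = refl

  shift-constant : ∀ j x → shift j (x · oneS R) ≋ monomial x j
  shift-constant j x n with ≤-<-connex j n
  ... | inj₂ n<j = trans (shift-below j _ n<j) (sym (monomial-off x j (<⇒≢ n<j)))
  ... | inj₁ j≤n with m≤n⇒m<n∨m≡n j≤n
  ...   | inj₁ j<n = begin
    shift j (x · oneS R) n  ≈⟨ shift-above j _ j≤n ⟩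
    x * oneS R (n ∸ j)      ≈⟨ *-congˡ (monomial-off 1# 0 (m>n⇒m∸n≢0 j<n)) ⟩
    x * 0#                  ≈⟨ zeroʳ x ⟩
    0#                      ≈⟨ sym (monomial-off x j (<⇒≢ j<n ∘ ≡.sym)) ⟩
    monomial x j n          ∎
  ...   | inj₂ ≡.refl = begin
    shift j (x · oneS R) j  ≈⟨ shift-above j _ ≤-refl ⟩
    x * oneS R (j ∸ j)      ≡⟨ ≡.cong (λ i → x * oneS R i) (n∸n≡0 j) ⟩
    x * oneS R 0            ≈⟨ *-congˡ (monomial-at 1# 0) ⟩
    x * 1#                  ≈⟨ *-identityʳ x ⟩
    x                       ≈⟨ sym (monomial-at x j) ⟩
    monomial x j j          ∎

  ⊛-congˡ : ∀ {a a′} b → a ≋ a′ → a ⊛ b ≋ a′ ⊛ b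
  ⊛-congˡ b a≋a′ n = ∑-cong n (λ k _ → *-congʳ (a≋a′ k))

  ⊛-congʳ : ∀ a {b b′} → b ≋ b′ → a ⊛ b ≋ a ⊛ b′
  ⊛-congʳ a b≋b′ n = ∑-cong n (λ k _ → *-congˡ (b≋b′ (n ∸ k)))

  -- Commutativity lets the linearity and shift laws be proved on the left and transported.
  ⊛-comm : ∀ a b → a ⊛ b ≋ b ⊛ a
  ⊛-comm a b n = begin
    ∑ n (λ k → a k * b (n ∸ k))             ≈⟨ ∑-reverse n _ ⟩
    ∑ n (λ k → a (n ∸ k) * b (n ∸ (n ∸ k))) ≈⟨ ∑-cong n (λ k k≤n →
                                                 trans (*-comm _ _) (*-congʳ (reflexive (≡.cong b (m∸[m∸n]≡n k≤n))))) ⟩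
    ∑ n (λ k → b k * a (n ∸ k))             ∎

  ⊛-⊕ˡ : ∀ a b c → (a ⊕ b) ⊛ c ≋ a ⊛ c ⊕ b ⊛ c
  ⊛-⊕ˡ a b c n = trans (∑-cong n (λ k _ → distribʳ (c (n ∸ k)) (a k) (b k))) (∑-+ n _ _)

  ⊛-⊝ˡ : ∀ a b c → (a ⊝ b) ⊛ c ≋ a ⊛ c ⊝ b ⊛ c
  ⊛-⊝ˡ a b c n = begin
    ∑ n (λ k → (a k - b k) * c (n ∸ k))                  ≈⟨ ∑-cong n (λ k _ → [y-z]x≈yx-zx _ _ _) ⟩
    ∑ n (λ k → a k * c (n ∸ k) - b k * c (n ∸ k))        ≈⟨ ∑-+ n _ _ ⟩
    (a ⊛ c) n + ∑ n (λ k → - (b k * c (n ∸ k)))          ≈⟨ +-congˡ (∑-neg n _) ⟩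
    (a ⊛ c) n - (b ⊛ c) n                                ∎

  ⊛-·ˡ : ∀ x a b → (x · a) ⊛ b ≋ x · (a ⊛ b)
  ⊛-·ˡ x a b n = trans (∑-cong n (λ k _ → *-assoc x (a k) _)) (∑-*ˡ n x _)

  monomial-⊛ : ∀ x j b → monomial x j ⊛ b ≋ x · shift j b
  monomial-⊛ x j b n with ≤-<-connex j n
  ... | inj₁ j≤n = begin
    ∑ n (λ k → monomial x j k * b (n ∸ k)) ≈⟨ ∑-single n j _ j≤n (λ k _ k≢j →
                                                trans (*-congʳ (monomial-off x j k≢j)) (zeroˡ _)) ⟩
    monomial x j j * b (n ∸ j)             ≈⟨ *-cong (monomial-at x j) (sym (shift-above j b j≤n)) ⟩
    x * shift j b n                        ∎
  ... | inj₂ n<j = begin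
    ∑ n (λ k → monomial x j k * b (n ∸ k)) ≈⟨ ∑-zero n _ (λ k k≤n →
                                                trans (*-congʳ (monomial-off x j (<⇒≢ (≤-trans (s≤s k≤n) n<j)))) (zeroˡ _)) ⟩
    0#                                     ≈⟨ sym (zeroʳ x) ⟩
    x * 0#                                 ≈⟨ *-congˡ (sym (shift-below j b n<j)) ⟩
    x * shift j b n                        ∎

  shift-⊛ : ∀ j a b → shift j a ⊛ b ≋ shift j (a ⊛ b)
  shift-⊛ j a b n with ≤-<-connex j n
  ... | inj₂ n<j = trans (∑-zero n _ (λ k k≤n → trans (*-congʳ (shift-below j a (≤-trans (s≤s k≤n) n<j))) (zeroˡ _)))
                         (sym (shift-below j (a ⊛ b) n<j))
  ... | inj₁ j≤n = begin
    (shift j a ⊛ b) n                                    ≡⟨ ≡.cong (shift j a ⊛ b) (≡.sym (m∸n+n≡m j≤n)) ⟩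
    ∑ (r +ℕ j) (λ k → shift j a k * b (r +ℕ j ∸ k))      ≈⟨ ∑-dropInitial r j _ (λ k k<j →
                                                            trans (*-congʳ (shift-below j a k<j)) (zeroˡ _)) ⟩
    ∑ r (λ k → shift j a (k +ℕ j) * b (r +ℕ j ∸ (k +ℕ j))) ≈⟨ ∑-cong r (λ k _ → *-cong (shiftedTerm k)
                                                                (reflexive (≡.cong b (shiftedIndex k)))) ⟩
    (a ⊛ b) r                                            ≈⟨ sym (shift-above j (a ⊛ b) j≤n) ⟩
    shift j (a ⊛ b) n                                    ∎
    where
    r = n ∸ j
    shiftedTerm : ∀ k → shift j a (k +ℕ j) ≈ a k
    shiftedTerm k = trans (shift-above j a (m≤n+m j k)) (reflexive (≡.cong a (m+n∸n≡m k j)))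
    shiftedIndex : ∀ k → r +ℕ j ∸ (k +ℕ j) ≡ r ∸ k
    shiftedIndex k = ≡.trans (≡.cong₂ _∸_ (ℕ.+-comm r j) (ℕ.+-comm k j)) ([m+n]∸[m+o]≡n∸o j r k)

  ⊛-⊕ʳ : ∀ a b c → a ⊛ (b ⊕ c) ≋ a ⊛ b ⊕ a ⊛ c
  ⊛-⊕ʳ a b c n = trans (⊛-comm a (b ⊕ c) n)
                   (trans (⊛-⊕ˡ b c a n) (+-cong (⊛-comm b a n) (⊛-comm c a n)))

  ⊛-·ʳ : ∀ x a b → a ⊛ (x · b) ≋ x · (a ⊛ b)
  ⊛-·ʳ x a b n = trans (⊛-comm a (x · b) n) (trans (⊛-·ˡ x b a n) (*-congˡ (⊛-comm b a n)))

  shift-⊛ʳ : ∀ j a b → a ⊛ shift j b ≋ shift j (a ⊛ b)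
  shift-⊛ʳ j a b n = trans (⊛-comm a (shift j b) n) (trans (shift-⊛ j b a n) (shift-cong j (⊛-comm b a) n))

  oneS-⊛ : ∀ b → oneS R ⊛ b ≋ b
  oneS-⊛ b n = trans (monomial-⊛ 1# 0 b n) (trans (*-identityˡ _) (shift-above 0 b z≤n))

  oneMinusQ^-⊛ : ∀ j b → oneMinusQ^ R j ⊛ b ≋ b ⊝ shift j b
  oneMinusQ^-⊛ j b n = begin
    (oneMinusQ^ R j ⊛ b) n                      ≈⟨ ⊛-⊕ˡ (oneS R) (monomial (- 1#) j) b n ⟩
    (oneS R ⊛ b) n + (monomial (- 1#) j ⊛ b) n  ≈⟨ +-cong (oneS-⊛ b n) (monomial-⊛ (- 1#) j b n) ⟩
    b n + - 1# * shift j b n                    ≈⟨ +-congˡ (-1*x≈-x _) ⟩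
    b n - shift j b n                           ∎

  ⊛-oneMinusQ^-low : ∀ j a {n} → n < j → (a ⊛ oneMinusQ^ R j) n ≈ a n
  ⊛-oneMinusQ^-low j a {n} n<j = begin
    (a ⊛ oneMinusQ^ R j) n  ≈⟨ ⊛-comm a (oneMinusQ^ R j) n ⟩
    (oneMinusQ^ R j ⊛ a) n  ≈⟨ oneMinusQ^-⊛ j a n ⟩
    a n - shift j a n       ≈⟨ +-congˡ (trans (-‿cong (shift-below j a n<j)) -0#≈0#) ⟩
    a n + 0#                ≈⟨ +-identityʳ _ ⟩
    a n                     ∎

  difference-⊛ : ∀ j a b → (a ⊝ shift j a) ⊛ b ≋ a ⊛ b ⊝ shift j (a ⊛ b)
  difference-⊛ j a b n = trans (⊛-⊝ˡ a (shift j a) b n) (+-congˡ (-‿cong (shift-⊛ j a b n)))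

  ⊛-oneMinusQ^-assoc : ∀ j a b → (a ⊛ oneMinusQ^ R j) ⊛ b ≋ a ⊛ (oneMinusQ^ R j ⊛ b)
  ⊛-oneMinusQ^-assoc j a b n = begin
    ((a ⊛ E) ⊛ b) n                ≈⟨ ⊛-congˡ b (λ i → trans (⊛-comm a E i) (oneMinusQ^-⊛ j a i)) n ⟩
    ((a ⊝ shift j a) ⊛ b) n        ≈⟨ difference-⊛ j a b n ⟩
    (a ⊛ b) n - shift j (a ⊛ b) n  ≈⟨ +-cong (⊛-comm a b n) (-‿cong (shift-cong j (⊛-comm a b) n)) ⟩
    (b ⊛ a) n - shift j (b ⊛ a) n  ≈⟨ sym (difference-⊛ j b a n) ⟩
    ((b ⊝ shift j b) ⊛ a) n        ≈⟨ sym (⊛-congˡ a (oneMinusQ^-⊛ j b) n) ⟩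
    ((E ⊛ b) ⊛ a) n                ≈⟨ ⊛-comm (E ⊛ b) a n ⟩
    (a ⊛ (E ⊛ b)) n                ∎
    where
    E : Series R
    E = oneMinusQ^ R j

  oneMinusQ^-solve : ∀ j {X Y} → X ≋ Y ⊕ shift j X → oneMinusQ^ R j ⊛ X ≋ Y
  oneMinusQ^-solve j {X} {Y} X≋ n = begin
    (oneMinusQ^ R j ⊛ X) n             ≈⟨ oneMinusQ^-⊛ j X n ⟩
    X n - shift j X n                  ≈⟨ +-congʳ (X≋ n) ⟩
    (Y n + shift j X n) - shift j X n  ≈⟨ //-rightDividesʳ (shift j X n) (Y n) ⟩
    Y n                                ∎

  sumOver : ∀ {A : Set} → (A → Carrier) → List A → Carrier
  sumOver φ xs = sumList R (map φ xs)

  sumOver-++ : ∀ {A : Set} (φ : A → Carrier) xs ys → sumOver φ (xs ++ ys) ≈ sumOver φ xs + sumOver φ ys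
  sumOver-++ φ []       ys = sym (+-identityˡ _)
  sumOver-++ φ (x ∷ xs) ys = trans (+-congˡ (sumOver-++ φ xs ys)) (sym (+-assoc _ _ _))

  sumOver-cong : ∀ {A : Set} {φ ψ : A → Carrier} {xs} → All (λ x → φ x ≈ ψ x) xs → sumOver φ xs ≈ sumOver ψ xs
  sumOver-cong []       = refl
  sumOver-cong (e ∷ es) = +-cong e (sumOver-cong es)

  sumOver-affine : ∀ {A : Set} x (φ : A → Carrier) xs →
                   sumOver (λ a → x + φ a) xs ≈ x * sumOver (λ _ → 1#) xs + sumOver φ xs
  sumOver-affine x φ []       = sym (trans (+-identityʳ _) (zeroʳ x))
  sumOver-affine x φ (a ∷ as) = begin
    (x + φ a) + sumOver (λ b → x + φ b) as                   ≈⟨ +-congˡ (sumOver-affine x φ as) ⟩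
    (x + φ a) + (x * sumOver (λ _ → 1#) as + sumOver φ as)   ≈⟨ interchange _ _ _ _ ⟩
    (x + x * sumOver (λ _ → 1#) as) + (φ a + sumOver φ as)   ≈⟨ +-congʳ (+-congʳ (sym (*-identityʳ x))) ⟩
    (x * 1# + x * sumOver (λ _ → 1#) as) + sumOver φ (a ∷ as) ≈⟨ +-congʳ (sym (distribˡ x _ _)) ⟩
    x * sumOver (λ _ → 1#) (a ∷ as) + sumOver φ (a ∷ as)     ∎

  eventuallyConstant : ∀ (u : ℕ → Carrier) k → (∀ m → k ≤ m → u (suc m) ≈ u m) → ∀ m → k ≤ m → u m ≈ u k
  eventuallyConstant u k step zero    z≤n   = refl
  eventuallyConstant u k step (suc m) k≤1+m with m≤n⇒m<n∨m≡n k≤1+m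
  ... | inj₁ (s≤s k≤m) = trans (step m k≤m) (eventuallyConstant u k step m k≤m)
  ... | inj₂ ≡.refl    = refl

-- Generating functions of partitions with bounded parts, weighted by g = distinctPartSum f.
module PartitionSeries {c ℓ : Level} (R : CommutativeRing c ℓ) (f : ℕ → CommutativeRing.Carrier R) where
  open CommutativeRing R hiding (zero)
  open PowerSeries R
  open PartitionLists
  open import Relation.Binary.Reasoning.Setoid setoid

  g : List ℕ → Carrier
  g = distinctPartSum R f

  partSum : (List ℕ → Carrier) → ℕ → Series R
  partSum φ m n = sumOver φ (partsLe n m)

  count : ℕ → Series R
  count = partSum (λ _ → 1#)

  S : ℕ → Series R
  S = partSum g

  partSum-split : ∀ φ m → partSum φ (suc m) ≋ partSum φ m ⊕ shift (suc m) (partSum (φ ∘ (suc m ∷_)) (suc m))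
  partSum-split φ m n with ≤-<-connex (suc m) n
  ... | inj₁ J≤n = begin
    sumOver φ (partsLe n (suc m))
      ≡⟨ ≡.cong (sumOver φ) (partsLe-split m n J≤n) ⟩
    sumOver φ (partsLe n m ++ map (suc m ∷_) (partsLe (n ∸ suc m) (suc m)))
      ≈⟨ sumOver-++ φ (partsLe n m) _ ⟩
    partSum φ m n + sumOver φ (map (suc m ∷_) (partsLe (n ∸ suc m) (suc m)))
      ≡⟨ ≡.cong (λ xs → partSum φ m n + sumList R xs) (≡.sym (map-∘ (partsLe (n ∸ suc m) (suc m)))) ⟩
    partSum φ m n + partSum (φ ∘ (suc m ∷_)) (suc m) (n ∸ suc m)
      ≈⟨ +-congˡ (sym (shift-above (suc m) _ J≤n)) ⟩
    partSum φ m n + shift (suc m) (partSum (φ ∘ (suc m ∷_)) (suc m)) n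
      ∎
  ... | inj₂ n<J = begin
    sumOver φ (partsLe n (suc m))  ≡⟨ ≡.cong (sumOver φ) (partsLe-small m n n<J) ⟩
    partSum φ m n                  ≈⟨ sym (+-identityʳ _) ⟩
    partSum φ m n + 0#             ≈⟨ +-congˡ (sym (shift-below (suc m) _ n<J)) ⟩
    partSum φ m n + shift (suc m) (partSum (φ ∘ (suc m ∷_)) (suc m)) n ∎

  module Step (m : ℕ) where
    J : ℕ
    J = suc m

    T : Series R
    T = partSum (g ∘ (J ∷_)) J

    -- J is not a part of μ when all parts of μ are ≤ m.
    g-fresh : ∀ {μ} → All (_≤ m) μ → g (J ∷ μ) ≡ f J + g μ
    g-fresh μ≤m = ≡.cong (sumList R ∘ map f)
      (distinctParts-fresh J _ (All.map (λ x≤m J≡x → <⇒≢ (s≤s x≤m) (≡.sym J≡x)) μ≤m))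

    count-rec : count J ≋ count m ⊕ shift J (count J)
    count-rec = partSum-split (λ _ → 1#) m

    S-rec : S J ≋ S m ⊕ shift J T
    S-rec = partSum-split g m

    T-rec : T ≋ (f J · count m ⊕ S m) ⊕ shift J T
    T-rec n = trans (partSum-split (g ∘ (J ∷_)) m n) (+-cong withoutRepeat (shift-cong J withRepeat n))
      where
      withoutRepeat : partSum (g ∘ (J ∷_)) m n ≈ f J * count m n + S m n
      withoutRepeat = trans (sumOver-cong (All.map (reflexive ∘ g-fresh) (partsLe-bounded n m)))
                            (sumOver-affine (f J) g (partsLe n m))
      withRepeat : partSum (g ∘ (J ∷_) ∘ (J ∷_)) J ≋ T
      withRepeat i = sumOver-cong (All.universal
        (λ λ′ → reflexive (≡.cong (sumList R ∘ map f) (distinctParts-repeat J λ′))) (partsLe i J))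

    T≋ : T ≋ f J · count m ⊕ S J
    T≋ n = begin
      T n                                        ≈⟨ T-rec n ⟩
      (f J * count m n + S m n) + shift J T n    ≈⟨ +-assoc _ _ _ ⟩
      f J * count m n + (S m n + shift J T n)    ≈⟨ +-congˡ (sym (S-rec n)) ⟩
      f J * count m n + S J n                    ∎

    count-difference : oneMinusQ^ R J ⊛ count J ≋ count m
    count-difference = oneMinusQ^-solve J count-rec

    S-difference : oneMinusQ^ R J ⊛ S J ≋ S m ⊕ shift J (f J · count m)
    S-difference = oneMinusQ^-solve J λ n → begin
      S J n                                                  ≈⟨ S-rec n ⟩
      S m n + shift J T n                                    ≈⟨ +-congˡ (trans (shift-cong J T≋ n) (shift-⊕ J _ _ n)) ⟩
      S m n + (shift J (f J · count m) n + shift J (S J) n)  ≈⟨ sym (+-assoc _ _ _) ⟩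
      (S m n + shift J (f J · count m) n) + shift J (S J) n  ∎

  qPoch : ℕ → Series R
  qPoch = qPochTo R

  fPartial : ℕ → Series R
  fPartial zero    = λ _ → 0#
  fPartial (suc m) = fPartial m ⊕ monomial (f (suc m)) (suc m)

  count-zero : count 0 ≋ oneS R
  count-zero zero    = +-identityʳ 1#
  count-zero (suc n) = sym (monomial-off 1# 0 {suc n} (λ ()))

  S-zero : S 0 ≋ (λ _ → 0#)
  S-zero zero    = +-identityʳ 0#
  S-zero (suc n) = refl

  qPoch-count : ∀ m → qPoch m ⊛ count m ≋ oneS R
  qPoch-count zero    n = trans (oneS-⊛ (count 0) n) (count-zero n)
  qPoch-count (suc m) n = begin
    ((qPoch m ⊛ oneMinusQ^ R J) ⊛ count J) n  ≈⟨ ⊛-oneMinusQ^-assoc J (qPoch m) (count J) n ⟩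
    (qPoch m ⊛ (oneMinusQ^ R J ⊛ count J)) n  ≈⟨ ⊛-congʳ (qPoch m) count-difference n ⟩
    (qPoch m ⊛ count m) n                     ≈⟨ qPoch-count m n ⟩
    oneS R n                                  ∎
    where open Step m

  qPoch-S : ∀ m → qPoch m ⊛ S m ≋ fPartial m
  qPoch-S zero    n = trans (oneS-⊛ (S 0) n) (S-zero n)
  qPoch-S (suc m) n = begin
    ((qPoch m ⊛ oneMinusQ^ R J) ⊛ S J) n                        ≈⟨ ⊛-oneMinusQ^-assoc J (qPoch m) (S J) n ⟩
    (qPoch m ⊛ (oneMinusQ^ R J ⊛ S J)) n                        ≈⟨ ⊛-congʳ (qPoch m) S-difference n ⟩
    (qPoch m ⊛ (S m ⊕ shift J (f J · count m))) n               ≈⟨ ⊛-⊕ʳ (qPoch m) (S m) (shift J (f J · count m)) n ⟩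
    (qPoch m ⊛ S m) n + (qPoch m ⊛ shift J (f J · count m)) n   ≈⟨ +-cong (qPoch-S m n) (shift-⊛ʳ J (qPoch m) _ n) ⟩
    fPartial m n + shift J (qPoch m ⊛ (f J · count m)) n        ≈⟨ +-congˡ (shift-cong J normalised n) ⟩
    fPartial m n + shift J (f J · oneS R) n                     ≈⟨ +-congˡ (shift-constant J (f J) n) ⟩
    fPartial m n + monomial (f J) J n                           ∎
    where
    open Step m
    normalised : qPoch m ⊛ (f J · count m) ≋ f J · oneS R
    normalised i = trans (⊛-·ʳ (f J) (qPoch m) (count m) i) (*-congˡ (qPoch-count m i))

  qPoch-stable : ∀ k m → k ≤ m → qPoch m k ≈ qPoch k k
  qPoch-stable k = eventuallyConstant (λ m → qPoch m k) k
    (λ m k≤m → ⊛-oneMinusQ^-low (suc m) (qPoch m) (s≤s k≤m))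

  S-stable : ∀ k m → k ≤ m → S m k ≈ S k k
  S-stable k = eventuallyConstant (λ m → S m k) k
    (λ m k≤m → reflexive (≡.cong (sumOver g) (partsLe-small m k (s≤s k≤m))))

  fPartial-vanishes : ∀ m n → m < n → fPartial m n ≈ 0#
  fPartial-vanishes zero    n _   = refl
  fPartial-vanishes (suc m) n m<n = trans
    (+-cong (fPartial-vanishes m n (<⇒≤ m<n)) (monomial-off (f (suc m)) (suc m) (<⇒≢ m<n ∘ ≡.sym)))
    (+-identityʳ 0#)

  fPartial-diagonal : ∀ n → fPartial n n ≈ posSeries R f n
  fPartial-diagonal zero    = refl
  fPartial-diagonal (suc n) = trans (+-cong (fPartial-vanishes n (suc n) ≤-refl) (monomial-at _ _)) (+-identityˡ _)

-- The q^n coefficient of the bracket is Σ_{k ≤ n} (q;q)_k[k] S_{n-k}[n-k]; replacing both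
-- factors by their truncations at n turns it into the q^n coefficient of (q;q)_n S_n.
theorem3 : {c ℓ : Level} (R : CommutativeRing c ℓ) (f : ℕ → CommutativeRing.Carrier R) (n : ℕ) →
    CommutativeRing._≈_ R (qBracket R (distinctPartSum R f) n) (posSeries R f n)
theorem3 R f n = begin
  qBracket R g n
    ≈⟨ ∑-cong n (λ k k≤n → *-cong (sym (qPoch-stable k n k≤n)) (sym (S-stable (n ∸ k) n (m∸n≤m n k)))) ⟩
  (qPoch n ⊛ S n) n  ≈⟨ qPoch-S n n ⟩
  fPartial n n       ≈⟨ fPartial-diagonal n ⟩
  posSeries R f n    ∎
  where
  open CommutativeRing R
  open PowerSeries R
  open PartitionSeries R f
  open import Relation.Binary.Reasoning.Setoid setoid
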